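{- Let $B$ be a finite subset of $\mathrm{M}$. Then $\mathrm{SAT}(\{\mathsf{F},\mathsf{G},\mathsf{X},\mathsf{U},\mathsf{S}\},B)$ can be decided in polynomial time.
   Context: A Boolean function is a map $f:\{0,1\}^n\to\{0,1\}$; each is used as an $n$-ary propositional connective. $\mathrm{M}$ is the set of monotone Boolean functions ($a_1\le b_1,\dots,a_n\le b_n$ implies $f(a_1,\dots,a_n)\le f(b_1,\dots,b_n)$). A temporal $B$-formula over a set $M$ of temporal operators is built from propositional variables using connectives from $B$ and operators from $M$. A structure $S=(s,V,\xi)$ is an infinite sequence $(s_i)_{i\in\mathbb N}$ of distinct states, a variable set $V$, and $\xi$ assigning to each state the set of variables true there. Semantics: $S,s_i\models x$ iff $x\in\xi(s_i)$; Boolean connectives pointwise; $S,s_i\models\mathsf{X}\varphi$ iff $S,s_{i+1}\models\varphi$; $S,s_i\models\varphi_1\mathsf{U}\varphi_2$ iff some $k\ge i$ has $S,s_k\models\varphi_2$ and $S,s_j\models\varphi_1$ for all $i\le j<k$; $S,s_i\models\varphi_1\mathsf{S}\varphi_2$ iff some $k\le i$ has $S,s_k\models\varphi_2$ and $S,s_j\models\varphi_1$ for all $k<j\le i$; $\mathsf{F}\varphi=\mathrm{true}\,\mathsf{U}\,\varphi$, $\mathsf{G}\varphi=\neg\mathsf{F}\neg\varphi$. A formula is satisfiable if it holds at some state of some structure. $\mathrm{SAT}(M,B)$ is the problem of deciding satisfiability of temporal $B$-formulae over $M$. -}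

module Defs where

open import Data.Nat using (ℕ; zero; suc; _≤_; _<_; _*_; _+_; _^_; _≡ᵇ_)
open import Data.Nat.Binary using (ℕᵇ; 2[1+_]; 1+[2_]) renaming (zero to zeroᵇ; fromℕ to toBin)
open import Data.Bool using (Bool; true; false; if_then_else_) renaming (_≤_ to _≤B_)
open import Data.Fin using (Fin; zero; suc; _↑ˡ_; _↑ʳ_; #_)
open import Data.Vec using (Vec; []; _∷_)
open import Data.Vec.Relation.Binary.Pointwise.Inductive using (Pointwise)
open import Data.List using (List; []; _∷_; _++_; [_]; length; lookup)
open import Data.Product using (Σ; _×_; proj₁; proj₂)
open import Data.Unit using (⊤)
open import Relation.Nullary using (¬_)
open import Relation.Binary.PropositionalEquality using (_≡_)

Conn : Set
Conn = Σ ℕ (λ n → Vec Bool n → Bool)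

-- Membership in M: monotone w.r.t. the pointwise order (false ≤ true).
Monotone : Conn → Set
Monotone (n Data.Product., f) =
  (a b : Vec Bool n) → Pointwise _≤B_ a b → f a ≤B f b

-- Temporal B-formulae over {F, G, X, U, S}; B is a finite set of
-- Boolean functions given as a list, connectives are indexed by position.

data Fml (B : List Conn) : Set where
  var  : ℕ → Fml B
  app  : (c : Fin (length B)) → Vec (Fml B) (proj₁ (lookup B c)) → Fml B
  𝐗 𝐅 𝐆 : Fml B → Fml B
  _𝐔_ _𝐒_ : Fml B → Fml B → Fml B

-- Structures: states s_0, s_1, ... identified with ℕ;
-- ξ i x = true iff variable x is true at state s_i.

Assign : Set
Assign = ℕ → ℕ → Bool

mutual
  Holds : {B : List Conn} → Assign → ℕ → Fml B → Set
  Holds ξ i (var x) = ξ i x ≡ true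
  Holds {B} ξ i (app c φs) =
    Σ (Vec Bool (proj₁ (lookup B c))) λ bs →
      (proj₂ (lookup B c) bs ≡ true) × Agree ξ i φs bs
  Holds ξ i (𝐗 φ) = Holds ξ (suc i) φ
  Holds ξ i (𝐅 φ) = Σ ℕ λ k → (i ≤ k) × Holds ξ k φ
  Holds ξ i (𝐆 φ) = ¬ (Σ ℕ λ k → (i ≤ k) × ¬ Holds ξ k φ)
  Holds ξ i (φ 𝐔 ψ) =
    Σ ℕ λ k → (i ≤ k) × Holds ξ k ψ × ((j : ℕ) → i ≤ j → j < k → Holds ξ j φ)
  Holds ξ i (φ 𝐒 ψ) =
    Σ ℕ λ k → (k ≤ i) × Holds ξ k ψ × ((j : ℕ) → k < j → j ≤ i → Holds ξ j φ)

  Agree : {B : List Conn} {n : ℕ} → Assign → ℕ → Vec (Fml B) n → Vec Bool n → Set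
  Agree ξ i [] [] = ⊤
  Agree ξ i (φ ∷ φs) (b ∷ bs) =
    (b ≡ true → Holds ξ i φ) × (b ≡ false → ¬ Holds ξ i φ) × Agree ξ i φs bs

Satisfiable : {B : List Conn} → Fml B → Set
Satisfiable φ = Σ Assign λ ξ → Σ ℕ λ i → Holds ξ i φ

Alph : List Conn → Set
Alph B = Fin (9 + length B)

sym : (B : List Conn) → Fin 9 → Alph B
sym B k = k ↑ˡ length B

encBin : (B : List Conn) → ℕᵇ → List (Alph B)
encBin B zeroᵇ = []
encBin B (2[1+ b ]) = sym B (# 7) ∷ encBin B b
encBin B (1+[2 b ]) = sym B (# 6) ∷ encBin B b

mutual
  enc : {B : List Conn} → Fml B → List (Alph B)
  enc {B} (var x) = sym B (# 5) ∷ (encBin B (toBin x) ++ [ sym B (# 8) ])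
  enc (app c φs) = (9 ↑ʳ c) ∷ encs φs
  enc {B} (𝐗 φ) = sym B (# 0) ∷ enc φ
  enc {B} (𝐅 φ) = sym B (# 1) ∷ enc φ
  enc {B} (𝐆 φ) = sym B (# 2) ∷ enc φ
  enc {B} (φ 𝐔 ψ) = sym B (# 3) ∷ (enc φ ++ enc ψ)
  enc {B} (φ 𝐒 ψ) = sym B (# 4) ∷ (enc φ ++ enc ψ)

  encs : {B : List Conn} {n : ℕ} → Vec (Fml B) n → List (Alph B)
  encs [] = []
  encs (φ ∷ φs) = enc φ ++ encs φs

SATlang : (B : List Conn) → List (Alph B) → Set
SATlang B w = Σ (Fml B) λ φ → (enc φ ≡ w) × Satisfiable φ

data Move : Set where
  L R : Move

data Action (Q Γ : Set) : Set where
  halt : Bool → Action Q Γ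
  go   : Q → Γ → Move → Action Q Γ

-- Input alphabet Fin s; states Fin (suc nQ) with start state zero;
-- tape alphabet Fin (suc (s + nΓ)): zero is blank, suc (a ↑ˡ nΓ) is input letter a.
record TM (s : ℕ) : Set where
  field
    nQ nΓ : ℕ
    δ : Fin (suc nQ) → Fin (suc (s + nΓ)) → Action (Fin (suc nQ)) (Fin (suc (s + nΓ)))

module _ {s : ℕ} (M : TM s) where
  open TM M

  State = Fin (suc nQ)
  Sym   = Fin (suc (s + nΓ))

  data Config : Set where
    running : State → (ℕ → Sym) → ℕ → Config
    done    : Bool → Config

  move : Move → ℕ → ℕ
  move L zero = zero
  move L (suc h) = h
  move R h = suc h

  write : (ℕ → Sym) → ℕ → Sym → ℕ → Sym
  write t h a j = if j ≡ᵇ h then a else t j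

  stepAct : (ℕ → Sym) → ℕ → Action State Sym → Config
  stepAct t h (halt b) = done b
  stepAct t h (go q a m) = running q (write t h a) (move m h)

  step : Config → Config
  step (running q t h) = stepAct t h (δ q (t h))
  step (done b) = done b

  runFor : ℕ → Config → Config
  runFor zero c = c
  runFor (suc n) c = runFor n (step c)

  initTape : List (Fin s) → ℕ → Sym
  initTape [] _ = zero
  initTape (a ∷ w) zero = suc (a ↑ˡ nΓ)
  initTape (a ∷ w) (suc j) = initTape w j

  initConfig : List (Fin s) → Config
  initConfig w = running zero (initTape w) zero

PolyTimeDecidable : {s : ℕ} → (List (Fin s) → Set) → Set
PolyTimeDecidable {s} P =
  Σ (TM s) λ M → Σ ℕ λ c → Σ ℕ λ d → (w : List (Fin s)) →
    Σ Bool λ b → (runFor M (c * length w ^ d + c) (initConfig M w) ≡ done {M = M} b)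
                 × (b ≡ true → P w) × (P w → b ≡ true)

module Submission where

-- Let ⊤ be the structure in which every variable holds at every state. All its
-- states look alike, so there X φ, F φ, G φ mean φ while φ U ψ and φ S ψ mean ψ,
-- and φ has a truth value topValue φ there. If φ holds anywhere in any structure
-- then topValue φ = true, by induction on φ: the temporal operators only consult
-- truth values their arguments take somewhere, and the connectives are monotone.
-- So φ is satisfiable iff topValue φ = true. This value is computed from the
-- Polish-notation encoding by a stack evaluation reading the word from right to
-- left, which a one-tape machine carries out by keeping the stack on the tape to
-- the right of the unread letters; each letter costs time linear in the length of
-- that region, so the machine runs in quadratic time.

open import Defs
open import Data.Nat using (ℕ; zero; suc; _≤_; z≤n; s≤s; _+_; _*_; _^_; _≡ᵇ_; _≟_)
open import Data.Nat.Binary using (ℕᵇ; 2[1+_]; 1+[2_]) renaming (zero to zeroᵇ; fromℕ to toBin; toℕ to fromBin)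
open import Data.Nat.Binary.Properties using (toℕ-injective; toℕ-fromℕ)
open import Data.Nat.Properties
  using (module ≤-Reasoning; ≤-refl; ≤-trans; ≤-reflexive; <-irrefl; +-mono-≤; +-suc; +-identityʳ;
         m≤n+m; m≤m+n; m≤n⇒m≤1+n; m≤n⇒∃[o]m+o≡n)
open import Data.Nat.Solver using (module +-*-Solver)
open +-*-Solver using (solve; _:+_; _:*_; _:^_; _:=_; con)
open import Data.Bool using (Bool; true; false; if_then_else_; b≤b) renaming (_≤_ to _≤B_)
open import Data.Bool.Properties using (≤-minimum)
open import Data.Fin using (Fin; zero; suc; _↑ˡ_; _↑ʳ_; #_; splitAt; join)
open import Data.Fin.Properties using (join-splitAt; splitAt-↑ˡ; splitAt-↑ʳ)
open import Data.Vec using (Vec; []; _∷_; toList)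
open import Data.Vec.Relation.Binary.Pointwise.Inductive using (Pointwise; []; _∷_)
open import Data.List
  using (List; []; _∷_; _++_; [_]; length; lookup; map; foldr; foldl; last; concatMap; reverse; drop; allFin; replicate)
open import Data.List.Properties
  using (++-assoc; ++-identityʳ; ∷-injectiveˡ; ∷ʳ-++; foldr-++; reverse-foldl; unfold-reverse; concatMap-++;
         length-reverse; length-++; length-replicate)
open import Data.List.Relation.Unary.All using (All)
import Data.List.Relation.Unary.All as All
open import Data.List.Relation.Unary.Any using (here; there)
import Data.List.Relation.Unary.Any as Any
open import Data.List.Relation.Unary.Any.Properties using (lookup-index)
open import Data.List.Membership.Propositional using (_∈_)
open import Data.List.Membership.Propositional.Properties
  using (∈-lookup; ∈-++⁺ˡ; ∈-++⁺ʳ; ∈-map⁺; ∈-allFin; ∈-concatMap⁺)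
open import Data.Maybe using (Maybe; just; nothing; fromMaybe)
open import Data.Product using (Σ; _×_; _,_; proj₁; proj₂)
open import Data.Sum using (inj₁; inj₂; [_,_]′)
open import Data.Unit using (tt)
open import Data.Empty using (⊥; ⊥-elim)
open import Function using (_∘_; flip)
open import Relation.Nullary using (¬_)
open import Relation.Nullary.Decidable using (recompute)
open import Relation.Binary.PropositionalEquality
  using (_≡_; _≗_; refl; trans; cong; subst; subst₂; module ≡-Reasoning) renaming (sym to ≡-sym)

module _ {B : List Conn} where

  mutual
    topValue : Fml B → Bool
    topValue (var x) = true
    topValue (app c φs) = proj₂ (lookup B c) (topValues φs)
    topValue (𝐗 φ) = topValue φ
    topValue (𝐅 φ) = topValue φ
    topValue (𝐆 φ) = topValue φ
    topValue (φ 𝐔 ψ) = topValue ψ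
    topValue (φ 𝐒 ψ) = topValue ψ

    topValues : {n : ℕ} → Vec (Fml B) n → Vec Bool n
    topValues [] = []
    topValues (φ ∷ φs) = topValue φ ∷ topValues φs

allTrue : Assign
allTrue _ _ = true

true≰false : ¬ (true ≤B false)
true≰false ()

module _ {B : List Conn} (mono : All Monotone B) where

  monotone : (c : Fin (length B)) → Monotone (lookup B c)
  monotone c = All.lookup mono (∈-lookup c)

  mutual
    topValue-true⇒holds : (φ : Fml B) → topValue φ ≡ true → ∀ i → Holds allTrue i φ
    topValue-true⇒holds (var x) _ i = refl
    topValue-true⇒holds (app c φs) e i = topValues φs , e , agree-allTrue φs i
    topValue-true⇒holds (𝐗 φ) e i = topValue-true⇒holds φ e (suc i)
    topValue-true⇒holds (𝐅 φ) e i = i , ≤-refl , topValue-true⇒holds φ e i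
    topValue-true⇒holds (𝐆 φ) e i (k , _ , ¬φ) = ¬φ (topValue-true⇒holds φ e k)
    topValue-true⇒holds (φ 𝐔 ψ) e i =
      i , ≤-refl , topValue-true⇒holds ψ e i , λ j i≤j j<i → ⊥-elim (<-irrefl refl (≤-trans j<i i≤j))
    topValue-true⇒holds (φ 𝐒 ψ) e i =
      i , ≤-refl , topValue-true⇒holds ψ e i , λ j i<j j≤i → ⊥-elim (<-irrefl refl (≤-trans i<j j≤i))

    topValue-false⇒¬holds : (φ : Fml B) → topValue φ ≡ false → ∀ ξ i → ¬ Holds ξ i φ
    topValue-false⇒¬holds (var x) () ξ i
    topValue-false⇒¬holds (app c φs) e ξ i (bs , fbs , agree) =
      true≰false (subst₂ _≤B_ fbs e (monotone c bs (topValues φs) (agree⇒≤topValues φs bs ξ i agree)))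
    topValue-false⇒¬holds (𝐗 φ) e ξ i = topValue-false⇒¬holds φ e ξ (suc i)
    topValue-false⇒¬holds (𝐅 φ) e ξ i (k , _ , h) = topValue-false⇒¬holds φ e ξ k h
    topValue-false⇒¬holds (𝐆 φ) e ξ i h = h (i , ≤-refl , topValue-false⇒¬holds φ e ξ i)
    topValue-false⇒¬holds (φ 𝐔 ψ) e ξ i (k , _ , h , _) = topValue-false⇒¬holds ψ e ξ k h
    topValue-false⇒¬holds (φ 𝐒 ψ) e ξ i (k , _ , h , _) = topValue-false⇒¬holds ψ e ξ k h

    agree-allTrue : {n : ℕ} (φs : Vec (Fml B) n) → ∀ i → Agree allTrue i φs (topValues φs)
    agree-allTrue [] i = tt
    agree-allTrue (φ ∷ φs) i =
      (λ e → topValue-true⇒holds φ e i) , (λ e → topValue-false⇒¬holds φ e allTrue i) , agree-allTrue φs i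

    agree⇒≤topValues : {n : ℕ} (φs : Vec (Fml B) n) (bs : Vec Bool n) →
      ∀ ξ i → Agree ξ i φs bs → Pointwise _≤B_ bs (topValues φs)
    agree⇒≤topValues [] [] ξ i _ = []
    agree⇒≤topValues (φ ∷ φs) (false ∷ bs) ξ i (_ , _ , agree) =
      ≤-minimum (topValue φ) ∷ agree⇒≤topValues φs bs ξ i agree
    agree⇒≤topValues (φ ∷ φs) (true ∷ bs) ξ i (φ-holds , _ , agree) =
      true≤topValue ∷ agree⇒≤topValues φs bs ξ i agree
      where
      true≤topValue : true ≤B topValue φ
      true≤topValue with topValue φ in e
      ... | true = b≤b
      ... | false = ⊥-elim (topValue-false⇒¬holds φ e ξ i (φ-holds refl))

  satisfiable⇒topValue : (φ : Fml B) → Satisfiable φ → topValue φ ≡ true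
  satisfiable⇒topValue φ (ξ , i , h) with topValue φ in e
  ... | true = refl
  ... | false = ⊥-elim (topValue-false⇒¬holds φ e ξ i h)

  topValue⇒satisfiable : (φ : Fml B) → topValue φ ≡ true → Satisfiable φ
  topValue⇒satisfiable φ e = allTrue , 0 , topValue-true⇒holds φ e 0

module Evaluation (B : List Conn) where
  open ≡-Reasoning

  data Op : Set where
    temporal   : Fin 5 → Op
    connective : Fin (length B) → Op

  arity : Op → ℕ
  arity (temporal zero) = 1
  arity (temporal (suc zero)) = 1
  arity (temporal (suc (suc zero))) = 1
  arity (temporal _) = 2
  arity (connective c) = proj₁ (lookup B c)

  fitVec : (n : ℕ) → List Bool → Vec Bool n
  fitVec zero bs = []
  fitVec (suc n) [] = false ∷ fitVec n []
  fitVec (suc n) (b ∷ bs) = b ∷ fitVec n bs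

  -- In the all-true structure every temporal operator returns its last argument.
  evalOp : Op → List Bool → Bool
  evalOp (temporal _) bs = fromMaybe false (last bs)
  evalOp (connective c) bs = proj₂ (lookup B c) (fitVec _ bs)

  data Token : Set where
    op       : Op → Token
    varStart : Token
    digit    : Bool → Token
    varEnd   : Token

  auxToken : Fin 4 → Token
  auxToken zero = varStart
  auxToken (suc zero) = digit false
  auxToken (suc (suc zero)) = digit true
  auxToken (suc (suc (suc zero))) = varEnd

  symbolToken : Fin 9 → Token
  symbolToken i = [ op ∘ temporal , auxToken ]′ (splitAt 5 i)

  tokenOf : Alph B → Token
  tokenOf a = [ symbolToken , op ∘ connective ]′ (splitAt 9 a)

  letterOf : Token → Alph B
  letterOf (op (temporal k)) = sym B (k ↑ˡ 4)
  letterOf (op (connective c)) = 9 ↑ʳ c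
  letterOf varStart = sym B (# 5)
  letterOf (digit false) = sym B (# 6)
  letterOf (digit true) = sym B (# 7)
  letterOf varEnd = sym B (# 8)

  letterOf-tokenOf : ∀ a → letterOf (tokenOf a) ≡ a
  letterOf-tokenOf a = trans (letterOf-join (splitAt 9 a)) (join-splitAt 9 (length B) a)
    where
    letterOf-auxToken : ∀ j → letterOf (auxToken j) ≡ sym B (5 ↑ʳ j)
    letterOf-auxToken zero = refl
    letterOf-auxToken (suc zero) = refl
    letterOf-auxToken (suc (suc zero)) = refl
    letterOf-auxToken (suc (suc (suc zero))) = refl

    letterOf-symbolToken : ∀ x → letterOf ([ op ∘ temporal , auxToken ]′ x) ≡ sym B (join 5 4 x)
    letterOf-symbolToken (inj₁ k) = refl
    letterOf-symbolToken (inj₂ j) = letterOf-auxToken j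

    letterOf-join : ∀ x → letterOf ([ symbolToken , op ∘ connective ]′ x) ≡ join 9 (length B) x
    letterOf-join (inj₁ i) = trans (letterOf-symbolToken (splitAt 5 i)) (cong (sym B) (join-splitAt 5 4 i))
    letterOf-join (inj₂ c) = refl

  data Phase : Set where
    scanning inVariable : Phase

  data EvalState : Set where
    stuck : EvalState
    at    : Phase → List Bool → EvalState

  splitAt? : ℕ → List Bool → Maybe (List Bool × List Bool)
  splitAt? zero bs = just ([] , bs)
  splitAt? (suc k) [] = nothing
  splitAt? (suc k) (b ∷ bs) with splitAt? k bs
  ... | nothing = nothing
  ... | just (xs , ys) = just (b ∷ xs , ys)

  push : Op → Maybe (List Bool × List Bool) → EvalState
  push o nothing = stuck
  push o (just (args , rest)) = at scanning (evalOp o args ∷ rest)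

  evalStep : Token → EvalState → EvalState
  evalStep _ stuck = stuck
  evalStep (op o) (at scanning s) = push o (splitAt? (arity o) s)
  evalStep varEnd (at scanning s) = at inVariable s
  evalStep (digit _) (at inVariable s) = at inVariable s
  evalStep varStart (at inVariable s) = at scanning (true ∷ s)
  evalStep _ _ = stuck

  stepLetter : Alph B → EvalState → EvalState
  stepLetter a = evalStep (tokenOf a)

  evaluate : List (Alph B) → EvalState
  evaluate = foldr stepLetter (at scanning [])

  accepting : EvalState → Bool
  accepting (at scanning (b ∷ [])) = b
  accepting _ = false

  decide : List (Alph B) → Bool
  decide w = accepting (evaluate w)

  splitAt?-toList : ∀ {n} (v : Vec Bool n) bs → splitAt? n (toList v ++ bs) ≡ just (toList v , bs)
  splitAt?-toList [] bs = refl
  splitAt?-toList (b ∷ v) bs rewrite splitAt?-toList v bs = refl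

  fitVec-toList : ∀ {n} (v : Vec Bool n) → fitVec n (toList v) ≡ v
  fitVec-toList [] = refl
  fitVec-toList (b ∷ v) = cong (b ∷_) (fitVec-toList v)

  evaluate-encBin : ∀ n s → foldr stepLetter (at inVariable s) (encBin B n) ≡ at inVariable s
  evaluate-encBin zeroᵇ s = refl
  evaluate-encBin 2[1+ n ] s rewrite evaluate-encBin n s = refl
  evaluate-encBin 1+[2 n ] s rewrite evaluate-encBin n s = refl

  mutual
    evaluate-enc : ∀ φ s → foldr stepLetter (at scanning s) (enc φ) ≡ at scanning (topValue φ ∷ s)
    evaluate-enc (var x) s =
      cong (stepLetter (sym B (# 5)))
        (trans (foldr-++ stepLetter (at scanning s) (encBin B (toBin x)) [ sym B (# 8) ]) (evaluate-encBin (toBin x) s))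
    evaluate-enc (app c φs) s
      rewrite evaluate-encs φs s | splitAt?-toList (topValues φs) s | fitVec-toList (topValues φs) = refl
    evaluate-enc (𝐗 φ) s = cong (stepLetter (sym B (# 0))) (evaluate-enc φ s)
    evaluate-enc (𝐅 φ) s = cong (stepLetter (sym B (# 1))) (evaluate-enc φ s)
    evaluate-enc (𝐆 φ) s = cong (stepLetter (sym B (# 2))) (evaluate-enc φ s)
    evaluate-enc (φ 𝐔 ψ) s = cong (stepLetter (sym B (# 3))) (evaluate-++ φ (enc ψ) (evaluate-enc ψ s))
    evaluate-enc (φ 𝐒 ψ) s = cong (stepLetter (sym B (# 4))) (evaluate-++ φ (enc ψ) (evaluate-enc ψ s))

    evaluate-encs : ∀ {n} (φs : Vec (Fml B) n) s →
      foldr stepLetter (at scanning s) (encs φs) ≡ at scanning (toList (topValues φs) ++ s)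
    evaluate-encs [] s = refl
    evaluate-encs (φ ∷ φs) s = evaluate-++ φ (encs φs) (evaluate-encs φs s)

    evaluate-++ : ∀ φ w {s t} → foldr stepLetter (at scanning s) w ≡ at scanning t →
      foldr stepLetter (at scanning s) (enc φ ++ w) ≡ at scanning (topValue φ ∷ t)
    evaluate-++ φ w {s} {t} e = begin
      foldr stepLetter (at scanning s) (enc φ ++ w)             ≡⟨ foldr-++ stepLetter _ (enc φ) w ⟩
      foldr stepLetter (foldr stepLetter (at scanning s) w) (enc φ) ≡⟨ cong (λ e → foldr stepLetter e (enc φ)) e ⟩
      foldr stepLetter (at scanning t) (enc φ)                  ≡⟨ evaluate-enc φ t ⟩
      at scanning (topValue φ ∷ t)                              ∎

  encList : List (Fml B) → List (Alph B)
  encList = concatMap enc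

  -- The suffix read so far encodes a list of formulae, preceded inside a variable
  -- by its binary digits and closing letter; the stack holds their top values.
  Parses : Phase → List (Alph B) → List Bool → Set
  Parses scanning w s =
    Σ (List (Fml B)) λ φs → (encList φs ≡ w) × (map topValue φs ≡ s)
  Parses inVariable w s =
    Σ ℕᵇ λ n → Σ (List (Fml B)) λ φs → (encBin B n ++ sym B (# 8) ∷ encList φs ≡ w) × (map topValue φs ≡ s)

  splitAt?-map : ∀ {A : Set} (f : A → Bool) k xs {ys zs} → splitAt? k (map f xs) ≡ just (ys , zs) →
    Σ (List A) λ xs₁ → Σ (List A) λ xs₂ →
      (xs ≡ xs₁ ++ xs₂) × (length xs₁ ≡ k) × (map f xs₁ ≡ ys) × (map f xs₂ ≡ zs)
  splitAt?-map f zero xs refl = [] , xs , refl , refl , refl , refl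
  splitAt?-map f (suc k) [] ()
  splitAt?-map f (suc k) (x ∷ xs) e with splitAt? k (map f xs) in e′
  splitAt?-map f (suc k) (x ∷ xs) () | nothing
  splitAt?-map f (suc k) (x ∷ xs) refl | just _ with splitAt?-map f k xs e′
  ... | xs₁ , xs₂ , refl , refl , refl , refl = x ∷ xs₁ , xs₂ , refl , refl , refl , refl

  listToVec : ∀ k (φs : List (Fml B)) → length φs ≡ k →
    Σ (Vec (Fml B) k) λ v → (encs v ≡ encList φs) × (toList (topValues v) ≡ map topValue φs)
  listToVec zero [] refl = [] , refl , refl
  listToVec (suc k) (φ ∷ φs) refl with listToVec k φs refl
  ... | v , e , e′ = φ ∷ v , cong (enc φ ++_) e , cong (topValue φ ∷_) e′

  applyOp : (o : Op) (args : List (Fml B)) → length args ≡ arity o →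
    Σ (Fml B) λ ψ → (enc ψ ≡ letterOf (op o) ∷ encList args) × (topValue ψ ≡ evalOp o (map topValue args))
  applyOp (temporal zero) (φ ∷ []) refl =
    𝐗 φ , cong (sym B (# 0) ∷_) (≡-sym (++-identityʳ (enc φ))) , refl
  applyOp (temporal (suc zero)) (φ ∷ []) refl =
    𝐅 φ , cong (sym B (# 1) ∷_) (≡-sym (++-identityʳ (enc φ))) , refl
  applyOp (temporal (suc (suc zero))) (φ ∷ []) refl =
    𝐆 φ , cong (sym B (# 2) ∷_) (≡-sym (++-identityʳ (enc φ))) , refl
  applyOp (temporal (suc (suc (suc zero)))) (φ ∷ ψ ∷ []) refl =
    φ 𝐔 ψ , cong (λ w → sym B (# 3) ∷ (enc φ ++ w)) (≡-sym (++-identityʳ (enc ψ))) , refl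
  applyOp (temporal (suc (suc (suc (suc zero))))) (φ ∷ ψ ∷ []) refl =
    φ 𝐒 ψ , cong (λ w → sym B (# 4) ∷ (enc φ ++ w)) (≡-sym (++-identityʳ (enc ψ))) , refl
  applyOp (connective c) args e with listToVec _ args e
  ... | v , encs-v , values-v =
    app c v , cong ((9 ↑ʳ c) ∷_) encs-v ,
    cong (proj₂ (lookup B c)) (trans (≡-sym (fitVec-toList (topValues v))) (cong (fitVec _) values-v))

  evalStep-preserves : ∀ t {p w s p′ s′} → Parses p w s → evalStep t (at p s) ≡ at p′ s′ →
    Parses p′ (letterOf t ∷ w) s′
  evalStep-preserves (op o) {scanning} (φs , refl , refl) e
    with splitAt? (arity o) (map topValue φs) in split
  ... | just _ with e | splitAt?-map topValue (arity o) φs split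
  ... | refl | args , φs′ , refl , length-args , refl , refl with applyOp o args length-args
  ... | ψ , enc-ψ , value-ψ =
    ψ ∷ φs′ ,
    trans (cong (_++ encList φs′) enc-ψ) (cong (letterOf (op o) ∷_) (≡-sym (concatMap-++ enc args φs′))) ,
    cong (_∷ map topValue φs′) value-ψ
  evalStep-preserves varEnd {scanning} (φs , refl , refl) refl = zeroᵇ , φs , refl , refl
  evalStep-preserves (digit false) {inVariable} (n , φs , refl , refl) refl = 1+[2 n ] , φs , refl , refl
  evalStep-preserves (digit true) {inVariable} (n , φs , refl , refl) refl = 2[1+ n ] , φs , refl , refl
  evalStep-preserves varStart {inVariable} (n , φs , refl , refl) refl =
    var (fromBin n) ∷ φs , cong (sym B (# 5) ∷_) encodes , refl
    where
    encodes : (encBin B (toBin (fromBin n)) ++ [ sym B (# 8) ]) ++ encList φs ≡ encBin B n ++ sym B (# 8) ∷ encList φs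
    encodes = trans (cong (λ m → (encBin B m ++ [ sym B (# 8) ]) ++ encList φs)
                          (toℕ-injective (toℕ-fromℕ (fromBin n))))
                    (++-assoc (encBin B n) [ sym B (# 8) ] (encList φs))
  evalStep-preserves (op o) {inVariable} _ ()
  evalStep-preserves varStart {scanning} _ ()
  evalStep-preserves (digit _) {scanning} _ ()
  evalStep-preserves varEnd {inVariable} _ ()

  evaluate-parses : ∀ w {p s} → evaluate w ≡ at p s → Parses p w s
  evaluate-parses [] refl = [] , refl , refl
  evaluate-parses (a ∷ w) e with evaluate w in e′
  ... | at p′ s′ =
    subst (λ b → Parses _ (b ∷ w) _) (letterOf-tokenOf a) (evalStep-preserves (tokenOf a) (evaluate-parses w e′) e)

  accepting-true : ∀ e → accepting e ≡ true → e ≡ at scanning (true ∷ [])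
  accepting-true (at scanning (true ∷ [])) refl = refl

module _ {B : List Conn} (mono : All Monotone B) where
  open Evaluation B

  decide-complete : ∀ w → SATlang B w → decide w ≡ true
  decide-complete w (φ , refl , sat) = cong accepting (begin
    evaluate (enc φ)              ≡⟨ evaluate-enc φ [] ⟩
    at scanning (topValue φ ∷ []) ≡⟨ cong (λ b → at scanning (b ∷ [])) (satisfiable⇒topValue mono φ sat) ⟩
    at scanning (true ∷ [])       ∎)
    where open ≡-Reasoning

  decide-sound : ∀ w → decide w ≡ true → SATlang B w
  decide-sound w e with evaluate-parses w (accepting-true (evaluate w) e)
  ... | φ ∷ [] , enc-φ , values =
    φ , trans (≡-sym (++-identityʳ (enc φ))) enc-φ , topValue⇒satisfiable mono φ (∷-injectiveˡ values)

reverse-∷-++ : ∀ {A : Set} (x : A) xs ys → reverse (x ∷ xs) ++ ys ≡ reverse xs ++ x ∷ ys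
reverse-∷-++ x xs ys = trans (cong (_++ ys) (unfold-reverse x xs)) (∷ʳ-++ (reverse xs) x ys)

replicate-∷ : ∀ {A : Set} m (x : A) xs → replicate m x ++ x ∷ xs ≡ x ∷ replicate m x ++ xs
replicate-∷ zero x xs = refl
replicate-∷ (suc m) x xs = cong (x ∷_) (replicate-∷ m x xs)

-- A transition function on abstract states and symbols, run on a zipper tape,
-- simulates the Turing machine obtained by encoding both into Fin.
module Simulation
  {s nQ nΓ : ℕ} {Q S : Set}
  (δ : Q → S → Action Q S) (blank : S) (input : Fin s → S)
  (encodeQ : Q → Fin (suc nQ)) (decodeQ : Fin (suc nQ) → Q)
  (decodeQ-encodeQ : ∀ q → decodeQ (encodeQ q) ≡ q)
  (encodeS : S → Fin (suc (s + nΓ))) (decodeS : Fin (suc (s + nΓ)) → S)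
  (decodeS-encodeS : ∀ x → decodeS (encodeS x) ≡ x)
  (decodeS-blank : decodeS zero ≡ blank)
  (decodeS-input : ∀ a → decodeS (suc (a ↑ˡ nΓ)) ≡ input a)
  where

  encodeAction : Action Q S → Action (Fin (suc nQ)) (Fin (suc (s + nΓ)))
  encodeAction (halt b) = halt b
  encodeAction (go q x m) = go (encodeQ q) (encodeS x) m

  machine : TM s
  machine = record { nQ = nQ ; nΓ = nΓ ; δ = λ q x → encodeAction (δ (decodeQ q) (decodeS x)) }

  -- The cells left of the head are stored nearest first.
  data Tape : Set where
    tape : List S → S → List S → Tape

  data Conf : Set where
    running : Q → Tape → Conf
    halted  : Bool → Conf

  headOrBlank : List S → S
  headOrBlank [] = blank
  headOrBlank (x ∷ _) = x

  shift : Move → Tape → Tape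
  shift L (tape [] x rs) = tape [] x rs
  shift L (tape (l ∷ ls) x rs) = tape ls l (x ∷ rs)
  shift R (tape ls x rs) = tape (x ∷ ls) (headOrBlank rs) (drop 1 rs)

  perform : List S → List S → Action Q S → Conf
  perform ls rs (halt b) = halted b
  perform ls rs (go q x m) = running q (shift m (tape ls x rs))

  stepᶻ : Conf → Conf
  stepᶻ (running q (tape ls x rs)) = perform ls rs (δ q x)
  stepᶻ (halted b) = halted b

  runᶻ : ℕ → Conf → Conf
  runᶻ zero c = c
  runᶻ (suc n) c = runᶻ n (stepᶻ c)

  cellAt : List S → ℕ → S
  cellAt [] j = blank
  cellAt (x ∷ xs) zero = x
  cellAt (x ∷ xs) (suc j) = cellAt xs j

  contents : Tape → ℕ → S
  contents (tape ls x rs) = cellAt (reverse ls ++ x ∷ rs)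

  position : Tape → ℕ
  position (tape ls _ _) = length ls

  cellAt-length : ∀ xs x rs → cellAt (xs ++ x ∷ rs) (length xs) ≡ x
  cellAt-length [] x rs = refl
  cellAt-length (_ ∷ xs) x rs = cellAt-length xs x rs

  cellAt-update : ∀ xs x y rs j →
    cellAt (xs ++ y ∷ rs) j ≡ (if j ≡ᵇ length xs then y else cellAt (xs ++ x ∷ rs) j)
  cellAt-update [] x y rs zero = refl
  cellAt-update [] x y rs (suc j) = refl
  cellAt-update (_ ∷ xs) x y rs zero = refl
  cellAt-update (_ ∷ xs) x y rs (suc j) = cellAt-update xs x y rs j

  cellAt-++ : ∀ xs {ys ys′} → cellAt ys ≗ cellAt ys′ → cellAt (xs ++ ys) ≗ cellAt (xs ++ ys′)
  cellAt-++ [] ys≗ys′ j = ys≗ys′ j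
  cellAt-++ (x ∷ xs) ys≗ys′ zero = refl
  cellAt-++ (x ∷ xs) ys≗ys′ (suc j) = cellAt-++ xs ys≗ys′ j

  cellAt-headOrBlank : ∀ rs → cellAt (headOrBlank rs ∷ drop 1 rs) ≗ cellAt rs
  cellAt-headOrBlank [] zero = refl
  cellAt-headOrBlank [] (suc j) = refl
  cellAt-headOrBlank (x ∷ rs) j = refl

  contents-head : ∀ ls x rs → contents (tape ls x rs) (length ls) ≡ x
  contents-head ls x rs =
    trans (cong (cellAt (reverse ls ++ x ∷ rs)) (≡-sym (length-reverse ls))) (cellAt-length (reverse ls) x rs)

  shift-contents : ∀ m ls x rs → contents (shift m (tape ls x rs)) ≗ contents (tape ls x rs)
  shift-contents L [] x rs j = refl
  shift-contents L (l ∷ ls) x rs j = cong (λ cs → cellAt cs j) (≡-sym (reverse-∷-++ l ls (x ∷ rs)))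
  shift-contents R ls x rs j =
    trans (cong (λ cs → cellAt cs j) (reverse-∷-++ x ls _)) (cellAt-++ (reverse ls) inner j)
    where
    inner : cellAt (x ∷ headOrBlank rs ∷ drop 1 rs) ≗ cellAt (x ∷ rs)
    inner zero = refl
    inner (suc j) = cellAt-headOrBlank rs j

  shift-position : ∀ m ls x rs → move machine m (length ls) ≡ position (shift m (tape ls x rs))
  shift-position L [] x rs = refl
  shift-position L (l ∷ ls) x rs = refl
  shift-position R ls x rs = refl

  Represents : Config machine → Conf → Set
  Represents (Defs.running q t h) (running q′ z) =
    (decodeQ q ≡ q′) × (h ≡ position z) × (∀ j → decodeS (t j) ≡ contents z j)
  Represents (done b) (halted b′) = b ≡ b′
  Represents _ _ = ⊥

  represents-write : ∀ t ls x y rs → (∀ j → decodeS (t j) ≡ contents (tape ls x rs) j) →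
    ∀ j → decodeS (write machine t (length ls) (encodeS y) j) ≡ contents (tape ls y rs) j
  represents-write t ls x y rs t≈ j
    rewrite cellAt-update (reverse ls) x y rs j | length-reverse ls with j ≡ᵇ length ls
  ... | true = decodeS-encodeS y
  ... | false = t≈ j

  simulate-step : ∀ c z → Represents c z → Represents (step machine c) (stepᶻ z)
  simulate-step (Defs.running q t .(length ls)) (running .(decodeQ q) (tape ls x rs)) (refl , refl , t≈)
    rewrite trans (t≈ (length ls)) (contents-head ls x rs)
    with δ (decodeQ q) x
  ... | halt b = refl
  ... | go q′ y m =
    decodeQ-encodeQ q′ , shift-position m ls y rs ,
    λ j → trans (represents-write t ls x y rs t≈ j) (≡-sym (shift-contents m ls y rs j))
  simulate-step (done b) (halted b′) e = e

  simulate : ∀ n c z → Represents c z → Represents (runFor machine n c) (runᶻ n z)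
  simulate zero c z c≈z = c≈z
  simulate (suc n) c z c≈z = simulate n (step machine c) (stepᶻ z) (simulate-step c z c≈z)

  initialTape : List (Fin s) → Tape
  initialTape w = tape [] (headOrBlank (map input w)) (drop 1 (map input w))

  represents-initial : ∀ w → Represents (initConfig machine w) (running (decodeQ zero) (initialTape w))
  represents-initial w = refl , refl , λ j → trans (decodeS-initTape w j) (≡-sym (cellAt-headOrBlank (map input w) j))
    where
    decodeS-initTape : ∀ w j → decodeS (initTape machine w j) ≡ cellAt (map input w) j
    decodeS-initTape [] j = decodeS-blank
    decodeS-initTape (a ∷ w) zero = decodeS-input a
    decodeS-initTape (a ∷ w) (suc j) = decodeS-initTape w j

  machine-halts : ∀ w n b → runᶻ n (running (decodeQ zero) (initialTape w)) ≡ halted b →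
    runFor machine n (initConfig machine w) ≡ done b
  machine-halts w n b e = done-of (runFor machine n (initConfig machine w))
    (subst (Represents _) e (simulate n _ _ (represents-initial w)))
    where
    done-of : ∀ c → Represents c (halted b) → c ≡ done b
    done-of (done b′) refl = refl

  Reaches : Conf → ℕ → Conf → Set
  Reaches c K c′ = Σ ℕ λ n → (n ≤ K) × (runᶻ n c ≡ c′)

  runᶻ-+ : ∀ m n c → runᶻ (m + n) c ≡ runᶻ n (runᶻ m c)
  runᶻ-+ zero n c = refl
  runᶻ-+ (suc m) n c = runᶻ-+ m n (stepᶻ c)

  reaches-refl : ∀ {c} → Reaches c 0 c
  reaches-refl = 0 , z≤n , refl

  reaches-step : ∀ {c c′ c″ K} → stepᶻ c ≡ c′ → Reaches c′ K c″ → Reaches c (suc K) c″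
  reaches-step e (n , n≤K , e′) = suc n , s≤s n≤K , trans (cong (runᶻ n) e) e′

  reaches-halt : ∀ {c b K} → stepᶻ c ≡ halted b → Reaches c (suc K) (halted b)
  reaches-halt e = 1 , s≤s z≤n , e

  reaches-trans : ∀ {c c′ c″ K K′} → Reaches c K c′ → Reaches c′ K′ c″ → Reaches c (K + K′) c″
  reaches-trans (m , m≤K , e) (n , n≤K′ , e′) =
    m + n , +-mono-≤ m≤K n≤K′ , trans (runᶻ-+ m n _) (trans (cong (runᶻ n) e) e′)

  reaches-mono : ∀ {c c′ K K′} → K ≤ K′ → Reaches c K c′ → Reaches c K′ c′
  reaches-mono K≤K′ (n , n≤K , e) = n , ≤-trans n≤K K≤K′ , e

  runᶻ-halted : ∀ n b → runᶻ n (halted b) ≡ halted b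
  runᶻ-halted zero b = refl
  runᶻ-halted (suc n) b = runᶻ-halted n b

  reaches-halted : ∀ {c b K N} → Reaches c K (halted b) → K ≤ N → runᶻ N c ≡ halted b
  reaches-halted {c} {b} (n , n≤K , e) K≤N with m≤n⇒∃[o]m+o≡n (≤-trans n≤K K≤N)
  ... | k , refl = trans (runᶻ-+ n k c) (trans (cong (runᶻ k) e) (runᶻ-halted k b))

letterCost : ℕ → ℕ
letterCost r = suc (suc (r + r))

scanCost : ℕ → ℕ → ℕ
scanCost zero r = suc (suc r)
scanCost (suc p) r = letterCost r + scanCost p (suc r)

1+[n+n+1+m]≡1+n+1+n+m : ∀ n m → suc (n + n + suc m) ≡ suc n + suc n + m
1+[n+n+1+m]≡1+n+1+n+m = solve 2 (λ n m → con 1 :+ (n :+ n :+ (con 1 :+ m)) := (con 1 :+ n) :+ (con 1 :+ n) :+ m) refl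

2+m≤1+n+1+n+m : ∀ n m → suc (suc m) ≤ suc n + suc n + m
2+m≤1+n+1+n+m n m = ≤-trans (m≤n+m (suc (suc m)) (n + n))
  (≤-reflexive (solve 2 (λ n m → (n :+ n) :+ (con 2 :+ m) := (con 1 :+ n) :+ (con 1 :+ n) :+ m) refl n m))

scanCost-closed : ∀ p r → scanCost p r ≡ suc p * (r + 2) + p * (p + r)
scanCost-closed zero r = solve 1 (λ r → con 2 :+ r := (con 1 :* (r :+ con 2)) :+ con 0) refl r
scanCost-closed (suc p) r = trans (cong (letterCost r +_) (scanCost-closed p (suc r)))
  (solve 2 (λ p r → (con 2 :+ (r :+ r)) :+ ((con 1 :+ p) :* ((con 1 :+ r) :+ con 2) :+ p :* (p :+ (con 1 :+ r)))
                  := (con 2 :+ p) :* (r :+ con 2) :+ (con 1 :+ p) :* ((con 1 :+ p) :+ r)) refl p r)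

total-cost : ∀ n → n + 1 + scanCost n 1 ≤ 9 * n ^ 2 + 9
total-cost zero = m≤m+n 4 5
total-cost (suc m) = begin
  suc m + 1 + scanCost (suc m) 1                              ≡⟨ cong (suc m + 1 +_) (scanCost-closed (suc m) 1) ⟩
  suc m + 1 + (suc (suc m) * 3 + suc m * (suc m + 1))        ≤⟨ m≤m+n _ (8 * m ^ 2 + 11 * m + 8) ⟩
  suc m + 1 + (suc (suc m) * 3 + suc m * (suc m + 1)) + (8 * m ^ 2 + 11 * m + 8)
    ≡⟨ solve 1 (λ m → ((con 1 :+ m) :+ con 1 :+ ((con 2 :+ m) :* con 3 :+ (con 1 :+ m) :* ((con 1 :+ m) :+ con 1)))
                       :+ (con 8 :* m :^ 2 :+ con 11 :* m :+ con 8)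
                     := con 9 :* (con 1 :+ m) :^ 2 :+ con 9) refl m ⟩
  9 * suc m ^ 2 + 9                                           ∎
  where open ≤-Reasoning

enumerateSplits : {A : Set} (n : ℕ) → ((args : List Bool) (r : ℕ) → .(length args + suc r ≡ n) → A) → List A
enumerateSplits zero f = []
enumerateSplits (suc n) f =
  f [] n refl ∷ (enumerateSplits n (λ args r e → f (true ∷ args) r (cong suc e)) ++
                 enumerateSplits n (λ args r e → f (false ∷ args) r (cong suc e)))

-- The proof passed to f need not be the one used in the list: the argument is irrelevant.
∈-enumerateSplits : {A : Set} (n : ℕ) (f : (args : List Bool) (r : ℕ) → .(length args + suc r ≡ n) → A) →
  ∀ args r (e : length args + suc r ≡ n) → f args r e ∈ enumerateSplits n f
∈-enumerateSplits (suc n) f [] r refl = here refl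
∈-enumerateSplits (suc n) f (true ∷ args) r refl =
  there (∈-++⁺ˡ (∈-enumerateSplits n _ args r refl))
∈-enumerateSplits (suc n) f (false ∷ args) r refl =
  there (∈-++⁺ʳ (enumerateSplits n _) (∈-enumerateSplits n _ args r refl))

module Machine (B : List Conn) where
  open Evaluation B
  open ≡-Reasoning

  s : ℕ
  s = 9 + length B

  data Cell : Set where
    blank  : Cell
    letter : Alph B → Cell
    value  : Bool → Cell
    used   : Cell
    mark   : Cell

  -- collect o args r gathers the arguments of o: args holds those read so far,
  -- most recent first, and r + 1 are still to come.
  data Control : Set where
    seekEnd return seekValue : Control
    read      : Phase → Control
    collect   : (o : Op) (args : List Bool) (r : ℕ) → .(length args + suc r ≡ arity o) → Control
    checkRest : Bool → Control

  Act : Set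
  Act = Action Control Cell

  startOp : (o : Op) (n : ℕ) → .(n ≡ arity o) → Act
  startOp o zero _ = go (read scanning) (value (evalOp o [])) L
  startOp o (suc r) e = go (collect o [] r e) mark R

  tokenAction : Phase → Token → Act
  tokenAction scanning (op o) = startOp o (arity o) refl
  tokenAction scanning varEnd = go (read inVariable) used L
  tokenAction inVariable (digit _) = go (read inVariable) used L
  tokenAction inVariable varStart = go (read scanning) (value true) L
  tokenAction _ _ = halt false

  δ : Control → Cell → Act
  δ seekEnd (letter a) = go seekEnd (letter a) R
  δ seekEnd _ = go (read scanning) used L  -- the blank after the input becomes a spent cell
  δ (read p) (letter a) = tokenAction p (tokenOf a)
  -- A non-letter under the head means all letters are read and the head is on cell 0.
  δ (read scanning) (value b) = go seekValue (value b) L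
  δ (read scanning) used = go seekValue used L
  δ (read _) _ = halt false
  δ (collect o args r e) used = go (collect o args r e) used R
  δ (collect o args zero _) (value b) = go return (value (evalOp o (reverse (b ∷ args)))) L
  δ (collect o args (suc r) e) (value b) =
    go (collect o (b ∷ args) r (trans (≡-sym (+-suc (length args) (suc r))) e)) used R
  δ (collect _ _ _ _) _ = halt false
  δ return used = go return used L
  δ return mark = go (read scanning) used L
  δ return _ = halt false
  δ seekValue used = go seekValue used R
  δ seekValue (value b) = go (checkRest b) (value b) R
  δ seekValue _ = halt false
  δ (checkRest b) used = go (checkRest b) used R
  δ (checkRest b) blank = halt b
  δ (checkRest _) _ = halt false

  encodeCell : Cell → Fin (suc (s + 4))
  encodeCell blank = zero
  encodeCell (letter a) = suc (a ↑ˡ 4)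
  encodeCell (value false) = suc (s ↑ʳ # 0)
  encodeCell (value true) = suc (s ↑ʳ # 1)
  encodeCell used = suc (s ↑ʳ # 2)
  encodeCell mark = suc (s ↑ʳ # 3)

  auxCell : Fin 4 → Cell
  auxCell zero = value false
  auxCell (suc zero) = value true
  auxCell (suc (suc zero)) = used
  auxCell (suc (suc (suc zero))) = mark

  decodeCell : Fin (suc (s + 4)) → Cell
  decodeCell zero = blank
  decodeCell (suc i) = [ letter , auxCell ]′ (splitAt s i)

  decodeCell-encodeCell : ∀ x → decodeCell (encodeCell x) ≡ x
  decodeCell-encodeCell blank = refl
  decodeCell-encodeCell (letter a) = cong [ letter , auxCell ]′ (splitAt-↑ˡ s a 4)
  decodeCell-encodeCell (value false) = cong [ letter , auxCell ]′ (splitAt-↑ʳ s 4 (# 0))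
  decodeCell-encodeCell (value true) = cong [ letter , auxCell ]′ (splitAt-↑ʳ s 4 (# 1))
  decodeCell-encodeCell used = cong [ letter , auxCell ]′ (splitAt-↑ʳ s 4 (# 2))
  decodeCell-encodeCell mark = cong [ letter , auxCell ]′ (splitAt-↑ʳ s 4 (# 3))

  allOps : List Op
  allOps = map temporal (allFin 5) ++ map connective (allFin (length B))

  ∈-allOps : ∀ o → o ∈ allOps
  ∈-allOps (temporal k) = ∈-++⁺ˡ (∈-map⁺ temporal (∈-allFin k))
  ∈-allOps (connective c) = ∈-++⁺ʳ (map temporal (allFin 5)) (∈-map⁺ connective (∈-allFin c))

  -- seekEnd comes first since the Turing machine starts in state zero.
  controls : List Control
  controls =
    seekEnd ∷ read scanning ∷ read inVariable ∷ return ∷ seekValue ∷ checkRest false ∷ checkRest true ∷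
    concatMap (λ o → enumerateSplits (arity o) (collect o)) allOps

  ∈-controls : ∀ q → q ∈ controls
  ∈-controls seekEnd = here refl
  ∈-controls (read scanning) = there (here refl)
  ∈-controls (read inVariable) = there (there (here refl))
  ∈-controls return = there (there (there (here refl)))
  ∈-controls seekValue = there (there (there (there (here refl))))
  ∈-controls (checkRest false) = there (there (there (there (there (here refl)))))
  ∈-controls (checkRest true) = there (there (there (there (there (there (here refl))))))
  ∈-controls (collect o args r e) = there (there (there (there (there (there (there
    (∈-concatMap⁺ (λ o → enumerateSplits (arity o) (collect o))
                  (Any.map (λ { refl → collect∈ }) (∈-allOps o)))))))))
    where
    collect∈ : collect o args r e ∈ enumerateSplits (arity o) (collect o)
    collect∈ = ∈-enumerateSplits (arity o) (collect o) args r (recompute (length args + suc r ≟ arity o) e)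

  encodeControl : Control → Fin (length controls)
  encodeControl q = Any.index (∈-controls q)

  decodeControl : Fin (length controls) → Control
  decodeControl = lookup controls

  decodeControl-encodeControl : ∀ q → decodeControl (encodeControl q) ≡ q
  decodeControl-encodeControl q = ≡-sym (lookup-index (∈-controls q))

  open Simulation δ blank letter encodeControl decodeControl decodeControl-encodeControl
    encodeCell decodeCell decodeCell-encodeCell refl (λ a → decodeCell-encodeCell (letter a)) public

  data Slot : Set where
    spent : Slot
    holds : Bool → Slot

  slotCell : Slot → Cell
  slotCell spent = used
  slotCell (holds b) = value b

  stackOf : List Slot → List Bool
  stackOf [] = []
  stackOf (spent ∷ ρ) = stackOf ρ
  stackOf (holds b ∷ ρ) = b ∷ stackOf ρ

  stackOf-spent : ∀ m ρ → stackOf (replicate m spent ++ ρ) ≡ stackOf ρ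
  stackOf-spent zero ρ = refl
  stackOf-spent (suc m) ρ = stackOf-spent m ρ

  -- The region ρ is the part of the tape right of the unread letters; the machine
  -- keeps the evaluator's stack there, interspersed with spent cells.
  atRegion : List Cell → List Slot → Tape
  atRegion ls ρ = tape ls (headOrBlank (map slotCell ρ)) (drop 1 (map slotCell ρ))

  -- v lists the unread letters, nearest to the head first.
  scanTape : List (Alph B) → List Slot → Tape
  scanTape [] ρ = atRegion [] ρ
  scanTape (a ∷ v) ρ = tape (map letter v) (letter a) (map slotCell ρ)

  shiftL-scanTape : ∀ v x ρ → shift L (tape (map letter v) (slotCell x) (map slotCell ρ)) ≡ scanTape v (x ∷ ρ)
  shiftL-scanTape [] x ρ = refl
  shiftL-scanTape (a ∷ v) x ρ = refl

  checkRest-run : ∀ b ls ρ →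
    Reaches (running (checkRest b) (atRegion ls ρ)) (suc (length ρ)) (halted (accepting (at scanning (b ∷ stackOf ρ))))
  checkRest-run b ls [] = reaches-halt refl
  checkRest-run b ls (spent ∷ ρ) = reaches-step refl (checkRest-run b (used ∷ ls) ρ)
  checkRest-run b ls (holds _ ∷ ρ) = reaches-halt refl

  seekValue-run : ∀ ls ρ →
    Reaches (running seekValue (atRegion ls ρ)) (suc (length ρ)) (halted (accepting (at scanning (stackOf ρ))))
  seekValue-run ls [] = reaches-halt refl
  seekValue-run ls (spent ∷ ρ) = reaches-step refl (seekValue-run (used ∷ ls) ρ)
  seekValue-run ls (holds b ∷ ρ) = reaches-step refl (checkRest-run b (value b ∷ ls) ρ)

  -- m spent cells lie between the operator's mark and the head.
  returnTape : List (Alph B) → ℕ → List Slot → Tape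
  returnTape v zero ρ = tape (map letter v) mark (map slotCell ρ)
  returnTape v (suc m) ρ = tape (replicate m used ++ mark ∷ map letter v) used (map slotCell ρ)

  shiftL-returnTape : ∀ v m x ρ →
    shift L (tape (replicate m used ++ mark ∷ map letter v) (slotCell x) (map slotCell ρ)) ≡ returnTape v m (x ∷ ρ)
  shiftL-returnTape v zero x ρ = refl
  shiftL-returnTape v (suc m) x ρ = refl

  return-run : ∀ v m ρ →
    runᶻ (suc m) (running return (returnTape v m ρ))
      ≡ running (read scanning) (scanTape v (spent ∷ replicate m spent ++ ρ))
  return-run v zero ρ = cong (running (read scanning)) (shiftL-scanTape v spent ρ)
  return-run v (suc m) ρ = begin
    runᶻ (suc m) (running return (shift L (tape (replicate m used ++ mark ∷ map letter v) used (map slotCell ρ))))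
      ≡⟨ cong (λ z → runᶻ (suc m) (running return z)) (shiftL-returnTape v m spent ρ) ⟩
    runᶻ (suc m) (running return (returnTape v m (spent ∷ ρ)))
      ≡⟨ return-run v m (spent ∷ ρ) ⟩
    running (read scanning) (scanTape v (spent ∷ replicate m spent ++ spent ∷ ρ))
      ≡⟨ cong (λ ρ′ → running (read scanning) (scanTape v (spent ∷ ρ′))) (replicate-∷ m spent ρ) ⟩
    running (read scanning) (scanTape v (spent ∷ spent ∷ replicate m spent ++ ρ)) ∎

  collectTape : List (Alph B) → ℕ → List Slot → Tape
  collectTape v m ρ = atRegion (replicate m used ++ mark ∷ map letter v) ρ

  CollectOutcome : Conf → List (Alph B) → Op → List Bool → ℕ → List Slot → Maybe (List Bool × List Bool) → Set
  CollectOutcome c v o args m ρ nothing = Reaches c (suc (length ρ)) (halted false)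
  CollectOutcome c v o args m ρ (just (xs , rest)) = Σ (List Slot) λ ρ′ →
    (stackOf ρ′ ≡ evalOp o (reverse args ++ xs) ∷ rest) × (length ρ′ ≡ suc (m + length ρ)) ×
    Reaches c (length ρ + length ρ + m) (running (read scanning) (scanTape v ρ′))

  collect-run : ∀ v o args r .(e : length args + suc r ≡ arity o) m ρ →
    CollectOutcome (running (collect o args r e) (collectTape v m ρ)) v o args m ρ (splitAt? (suc r) (stackOf ρ))
  collect-run v o args r e m [] = reaches-halt refl
  collect-run v o args r e m (spent ∷ ρ)
    with splitAt? (suc r) (stackOf ρ) | collect-run v o args r e (suc m) ρ
  ... | nothing | halts = reaches-step refl halts
  ... | just _ | ρ′ , stack , len , reaches =
    ρ′ , stack , trans len (cong suc (≡-sym (+-suc m (length ρ)))) ,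
    reaches-mono (≤-reflexive (1+[n+n+1+m]≡1+n+1+n+m (length ρ) m)) (reaches-step refl reaches)
  collect-run v o args (suc r) e m (holds b ∷ ρ)
    with splitAt? (suc r) (stackOf ρ) | collect-run v o (b ∷ args) r _ (suc m) ρ
  ... | nothing | halts = reaches-step refl halts
  ... | just (xs , _) | ρ′ , stack , len , reaches =
    ρ′ , trans stack (cong (λ as → evalOp o as ∷ _) (reverse-∷-++ b args xs)) ,
    trans len (cong suc (≡-sym (+-suc m (length ρ)))) ,
    reaches-mono (≤-reflexive (1+[n+n+1+m]≡1+n+1+n+m (length ρ) m)) (reaches-step refl reaches)
  collect-run v o args zero e m (holds b ∷ ρ) =
    spent ∷ replicate m spent ++ holds result ∷ ρ ,
    trans (stackOf-spent m (holds result ∷ ρ)) (cong (λ as → evalOp o as ∷ stackOf ρ) (unfold-reverse b args)) ,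
    cong suc (trans (length-++ (replicate m spent)) (cong (_+ suc (length ρ)) (length-replicate m))) ,
    reaches-mono (2+m≤1+n+1+n+m (length ρ) m)
      (reaches-step (cong (running return) (shiftL-returnTape v m (holds result) ρ))
                    (suc m , ≤-refl , return-run v m (holds result ∷ ρ)))
    where
    result = evalOp o (reverse (b ∷ args))

  LetterOutcome : Conf → EvalState → List (Alph B) → List Slot → Set
  LetterOutcome c stuck v ρ = Reaches c (letterCost (length ρ)) (halted false)
  LetterOutcome c (at p s) v ρ = Σ (List Slot) λ ρ′ →
    (stackOf ρ′ ≡ s) × (length ρ′ ≡ suc (length ρ)) ×
    Reaches c (letterCost (length ρ)) (running (read p) (scanTape v ρ′))

  moveLeft-outcome : ∀ {c} p x v ρ → stepᶻ c ≡ perform (map letter v) (map slotCell ρ) (go (read p) (slotCell x) L) →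
    Reaches c (letterCost (length ρ)) (running (read p) (scanTape v (x ∷ ρ)))
  moveLeft-outcome p x v ρ e =
    reaches-mono (s≤s z≤n) (reaches-step (trans e (cong (running (read p)) (shiftL-scanTape v x ρ))) reaches-refl)

  startOp-outcome : ∀ {c} o n .(e : n ≡ arity o) v ρ →
    stepᶻ c ≡ perform (map letter v) (map slotCell ρ) (startOp o n e) →
    LetterOutcome c (push o (splitAt? n (stackOf ρ))) v ρ
  startOp-outcome o zero e v ρ step = holds (evalOp o []) ∷ ρ , refl , refl , moveLeft-outcome scanning (holds _) v ρ step
  startOp-outcome o (suc r) e v ρ step with splitAt? (suc r) (stackOf ρ) | collect-run v o [] r e 0 ρ
  ... | nothing | halts = reaches-mono (s≤s (s≤s (m≤m+n (length ρ) (length ρ)))) (reaches-step step halts)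
  ... | just _ | ρ′ , stack , len , reaches =
    ρ′ , stack , len , reaches-mono (s≤s (m≤n⇒m≤1+n (≤-reflexive (+-identityʳ _)))) (reaches-step step reaches)

  letter-outcome : ∀ t p v ρ {c} → stepᶻ c ≡ perform (map letter v) (map slotCell ρ) (tokenAction p t) →
    LetterOutcome c (evalStep t (at p (stackOf ρ))) v ρ
  letter-outcome (op o) scanning v ρ step = startOp-outcome o (arity o) refl v ρ step
  letter-outcome varEnd scanning v ρ step = spent ∷ ρ , refl , refl , moveLeft-outcome inVariable spent v ρ step
  letter-outcome (digit _) inVariable v ρ step = spent ∷ ρ , refl , refl , moveLeft-outcome inVariable spent v ρ step
  letter-outcome varStart inVariable v ρ step =
    holds true ∷ ρ , refl , refl , moveLeft-outcome scanning (holds true) v ρ step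
  letter-outcome (op o) inVariable v ρ step = reaches-halt step
  letter-outcome varStart scanning v ρ step = reaches-halt step
  letter-outcome (digit _) scanning v ρ step = reaches-halt step
  letter-outcome varEnd inVariable v ρ step = reaches-halt step

  foldl-stuck : ∀ v → foldl (flip stepLetter) stuck v ≡ stuck
  foldl-stuck [] = refl
  foldl-stuck (a ∷ v) = foldl-stuck v

  scan-run : ∀ v p ρ →
    Reaches (running (read p) (scanTape v ρ)) (scanCost (length v) (length ρ))
            (halted (accepting (foldl (flip stepLetter) (at p (stackOf ρ)) v)))
  scan-run [] scanning [] = reaches-halt refl
  scan-run [] scanning (spent ∷ ρ) = reaches-step refl (seekValue-run [] (spent ∷ ρ))
  scan-run [] scanning (holds b ∷ ρ) = reaches-step refl (seekValue-run [] (holds b ∷ ρ))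
  scan-run [] inVariable [] = reaches-halt refl
  scan-run [] inVariable (spent ∷ ρ) = reaches-halt refl
  scan-run [] inVariable (holds _ ∷ ρ) = reaches-halt refl
  scan-run (a ∷ v) p ρ with evalStep (tokenOf a) (at p (stackOf ρ)) | letter-outcome (tokenOf a) p v ρ refl
  ... | stuck | halts rewrite foldl-stuck v = reaches-mono (m≤m+n _ _) halts
  ... | at p′ _ | ρ′ , refl , len , reaches =
    reaches-trans reaches (reaches-mono (≤-reflexive (cong (scanCost (length v)) len)) (scan-run v p′ ρ′))

  startScan : List (Alph B) → Conf
  startScan v = running (read scanning) (scanTape v (spent ∷ []))

  seekEnd-run : ∀ u v →
    runᶻ (length u + 1) (running seekEnd (tape (map letter v) (headOrBlank (map letter u)) (drop 1 (map letter u))))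
      ≡ startScan (reverse u ++ v)
  seekEnd-run [] [] = refl
  seekEnd-run [] (a ∷ v) = refl
  seekEnd-run (a ∷ u) v = trans (seekEnd-run u (a ∷ v)) (cong startScan (≡-sym (reverse-∷-++ a u v)))

  machine-run : ∀ w → Reaches (running seekEnd (initialTape w)) (length w + 1 + scanCost (length w) 1) (halted (decide w))
  machine-run w = reaches-trans (length w + 1 , ≤-refl , reach-end) scan
    where
    reach-end : runᶻ (length w + 1) (running seekEnd (initialTape w)) ≡ startScan (reverse w)
    reach-end = trans (seekEnd-run w []) (cong startScan (++-identityʳ (reverse w)))

    scan : Reaches (startScan (reverse w)) (scanCost (length w) 1) (halted (decide w))
    scan = subst₂ (λ n e → Reaches (startScan (reverse w)) (scanCost n 1) (halted (accepting e)))
             (length-reverse w) (reverse-foldl (flip stepLetter) (at scanning []) w)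
             (scan-run (reverse w) scanning (spent ∷ []))

theorem3p7 : (B : List Conn) → All Monotone B → PolyTimeDecidable (SATlang B)
theorem3p7 B mono = machine , 9 , 2 , λ w → decide w , halts-in-time w , decide-sound mono w , decide-complete mono w
  where
  open Evaluation B
  open Machine B

  halts-in-time : ∀ w → runFor machine (9 * length w ^ 2 + 9) (initConfig machine w) ≡ done (decide w)
  halts-in-time w =
    machine-halts w (9 * length w ^ 2 + 9) (decide w) (reaches-halted (machine-run w) (total-cost (length w)))
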